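{- Let $n\ge1$ and let $K_n$ be the complete reflexive graph on $n$ vertices. Within the class $\mathcal{G}_R$ of all finite reflexive graphs under the strong homomorphic image ordering, the avoidance class $\mathrm{Av}(K_n)$ is well quasi-ordered.
   Context: A reflexive graph is a set with a symmetric edge relation containing all loops; $K_n$ has all pairs of its $n$ vertices as edges. A homomorphism $\phi:H\to G$ maps edges to edges; it is strong if moreover every edge of $G$ between vertices of $\phi(H)$ is the image of an edge of $H$. Strong homomorphic image ordering: $A\preceq B$ iff there is a surjective strong homomorphism $B\to A$. $\mathrm{Av}(K_n)=\{H\in\mathcal{G}_R:K_n\not\preceq H\}$. Well quasi-ordered means: no infinite strictly decreasing sequence and no infinite antichain. -}

module Defs where

open import Data.Nat using (ℕ; _<_)
open import Data.Fin using (Fin)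
open import Data.Bool using (Bool; true)
open import Data.Product using (Σ; ∃; _×_; _,_)
open import Relation.Binary.PropositionalEquality using (_≡_; _≢_)
open import Relation.Nullary using (¬_)

record RGraph : Set where
  field
    size  : ℕ
    adj   : Fin size → Fin size → Bool
    symm  : ∀ i j → adj i j ≡ adj j i
    loops : ∀ i → adj i i ≡ true
open RGraph public

Edge : (G : RGraph) → Fin (size G) → Fin (size G) → Set
Edge G i j = adj G i j ≡ true

IsHom : (H G : RGraph) → (Fin (size H) → Fin (size G)) → Set
IsHom H G φ = ∀ i j → Edge H i j → Edge G (φ i) (φ j)

IsStrong : (H G : RGraph) → (Fin (size H) → Fin (size G)) → Set
IsStrong H G φ = ∀ i j → Edge G (φ i) (φ j) →
  Σ (Fin (size H)) λ i' → Σ (Fin (size H)) λ j' →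
    (φ i' ≡ φ i) × (φ j' ≡ φ j) × Edge H i' j'

IsSurj : {a b : ℕ} → (Fin a → Fin b) → Set
IsSurj {a} {b} φ = ∀ (y : Fin b) → Σ (Fin a) λ x → φ x ≡ y

_≼_ : RGraph → RGraph → Set
A ≼ B = Σ (Fin (size B) → Fin (size A)) λ φ →
  IsHom B A φ × IsStrong B A φ × IsSurj φ

_≺_ : RGraph → RGraph → Set
A ≺ B = (A ≼ B) × ¬ (B ≼ A)

K : ℕ → RGraph
K n = record { size = n ; adj = λ _ _ → true
             ; symm = λ _ _ → _≡_.refl ; loops = λ _ → _≡_.refl }

InAv : ℕ → RGraph → Set
InAv n H = ¬ (K n ≼ H)

WQO : (RGraph → Set) → Set
WQO C =
  (¬ Σ (ℕ → RGraph) λ f → (∀ i → C (f i)) × (∀ i → f (Data.Nat.suc i) ≺ f i))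
  ×
  (¬ Σ (ℕ → RGraph) λ f → (∀ i → C (f i)) ×
       (∀ i j → i ≢ j → ¬ (f i ≼ f j)))

module Submission where

-- Read constructively, well-quasi-ordering of Av(K n) follows
-- once every infinite sequence f of graphs in Av(K n) is *good*: f i ≼ f j for
-- some i < j.  Goodness is obtained from an almost full relation in the sense
-- of Coquand et al. (an inductive, constructive form of wqo).
--   1. Almost full relations: ≤ on ℕ is almost full, and almost fullness is
--      stable under pullback, weakening and intersection (Coquand's
--      intersection theorem), hence under finite intersections.
--   2. Counting with rank/select for boolean predicates on Fin m.
--   3. A greedy maximal matching in H; its endpoints form a vertex cover, and
--      a matching with n² edges exhibits K n as a strong image of H.  So every
--      graph of Av(K n) has a vertex cover of at most 2n² vertices.
--   4. A graph with a cover of at most κ vertices has a code: cover size, the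
--      adjacency profiles of the cover vertices, and for each profile the
--      number of non-cover vertices having it (they form an independent set).
--      If the code of G is dominated by that of G' (equal cover data, fewer
--      vertices per profile, with the same profiles occurring) then G ≼ G'.
--   5. Domination of codes is an intersection of almost full relations, so
--      sequences in Av(K n) are good; goodness rules out infinite antichains
--      and infinite strictly descending chains.

open import Defs
open import Data.Nat using (ℕ; zero; suc; _≤_; _<_; _≥_; _+_; _*_; _∸_; z≤n; s≤s)
open import Data.Nat.Properties
  using (≤-trans; ≤-reflexive; ≤-antisym; ≤-<-trans; <-≤-trans; <⇒≤; <⇒≢; ≰⇒>; _≤?_; _<?_;
         ∸-cancelʳ-≤; <-irrelevant; suc-injective; +-suc; +-monoʳ-≤; +-mono-≤; n≤1+n; m∸n+n≡m)
open import Data.Nat.Induction using (<-wellFounded)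
open import Induction.WellFounded using (Acc; acc)
open import Data.Bool using (Bool; true; false; _∨_)
import Data.Bool.Properties as Bool
open import Data.Fin using (Fin; toℕ; fromℕ<; remQuot; combine) renaming (zero to fz; suc to fs)
open import Data.Fin.Properties using (_≟_; any?; toℕ-fromℕ<; remQuot-combine)
open import Data.Vec using (Vec; []; _∷_; head; tail; tabulate; lookup; replicate)
open import Data.Vec.Properties using (lookup∘tabulate) renaming (≡-dec to ≡-dec-Vec)
open import Data.List using (List; []; _∷_; length; zip; allFin) renaming (tabulate to tabulateᴸ)
open import Data.List.Properties using (length-tabulate)
open import Data.List.Relation.Unary.Any using (here; there)
open import Data.List.Membership.Propositional using (_∈_; _∉_)
open import Data.List.Membership.Propositional.Properties using (∈-allFin; ∈-tabulate⁺)
open import Data.Product using (Σ; ∃; _×_; _,_; proj₁; proj₂)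
open import Data.Sum using (_⊎_; inj₁; inj₂)
open import Data.Empty using (⊥-elim)
open import Relation.Nullary using (Dec; yes; no; does; ¬_; ¬?; _×-dec_)
open import Relation.Nullary.Decidable using (dec-true)
open import Relation.Binary.Core using (Rel)
open import Relation.Binary.Construct.Intersection using (_∩_)
open import Relation.Binary.PropositionalEquality
  using (_≡_; _≢_; refl; sym; trans; cong; cong₂; subst; module ≡-Reasoning)
open import Level using (0ℓ)

-- A relation is almost full if, after finitely many observations x₁, x₂, …
-- (each one weakening R to  R y z ⊎ R x y), it relates every pair.
data AF {X : Set} : Rel X 0ℓ → Set₁ where
  now   : ∀ {R} → (∀ x y → R x y) → AF R
  later : ∀ {R} → (∀ x → AF (λ y z → R y z ⊎ R x y)) → AF R

_⊆_ : {X : Set} → Rel X 0ℓ → Rel X 0ℓ → Set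
R ⊆ S = ∀ x y → R x y → S x y

af-mono : {X : Set} {R S : Rel X 0ℓ} → AF R → R ⊆ S → AF S
af-mono (now r)   R⊆S = now λ x y → R⊆S x y (r x y)
af-mono (later r) R⊆S = later λ x → af-mono (r x) λ where
  y z (inj₁ ryz) → inj₁ (R⊆S y z ryz)
  y z (inj₂ rxy) → inj₂ (R⊆S x y rxy)

af-pull : {X Y : Set} {R : Rel Y 0ℓ} → AF R → (h : X → Y) → AF (λ a b → R (h a) (h b))
af-pull (now r)   h = now λ x y → r (h x) (h y)
af-pull (later r) h = later λ x → af-pull (r (h x)) h

good : {X : Set} {R : Rel X 0ℓ} → AF R → (f : ℕ → X) →
       Σ ℕ λ i → Σ ℕ λ j → i < j × R (f i) (f j)
good (now r) f = 0 , 1 , s≤s z≤n , r (f 0) (f 1)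
good (later r) f with good (r (f 0)) (λ k → f (suc k))
... | i , j , i<j , inj₁ rij = suc i , suc j , s≤s i<j , rij
... | i , j , i<j , inj₂ r0i = 0 , suc i , s≤s z≤n , r0i

-- The usual order on ℕ is almost full: once x is observed, only values
-- below x can avoid being ≥ x, and these are handled by well-founded induction.
af-≤ : AF {ℕ} _≤_
af-≤ = later λ x → below x (<-wellFounded x)
  where
  below : ∀ m → Acc _<_ m → AF {ℕ} (λ y z → y ≤ z ⊎ m ≤ y)
  below m (acc rs) = later λ x → observe x (m ≤? x)
    where
    observe : ∀ x → Dec (m ≤ x) → AF {ℕ} (λ y z → (y ≤ z ⊎ m ≤ y) ⊎ (x ≤ y ⊎ m ≤ x))
    observe x (yes m≤x) = now λ _ _ → inj₂ (inj₂ m≤x)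
    observe x (no m≰x)  = af-mono (below x (rs (≰⇒> m≰x))) λ where
      y z (inj₁ y≤z) → inj₁ (inj₁ y≤z)
      y z (inj₂ x≤y) → inj₂ (inj₁ x≤y)

meet : {W P Q : Set} → W ⊎ P → W ⊎ Q → W ⊎ (P × Q)
meet (inj₁ w) _        = inj₁ w
meet (inj₂ p) (inj₁ w) = inj₁ w
meet (inj₂ p) (inj₂ q) = inj₂ (p , q)

af-nullary : {X : Set} {A B W : Rel X 0ℓ} {P Q : Set} → AF A → AF B →
             A ⊆ (λ y z → W y z ⊎ P) → B ⊆ (λ y z → W y z ⊎ Q) →
             AF (λ y z → W y z ⊎ (P × Q))
af-nullary (now a) afB A⊆ B⊆ = af-mono afB λ y z b → meet (A⊆ y z (a y z)) (B⊆ y z b)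
af-nullary (later a) (now b) A⊆ B⊆ =
  af-mono (later a) λ y z r → meet (A⊆ y z r) (B⊆ y z (b y z))
af-nullary {A = A} {W = W} {P} {Q} (later a) (later b) A⊆ B⊆ = later λ x →
  af-mono (af-nullary (a x) (later b) (A⊆ₓ x) (λ y z r → weaken (B⊆ y z r))) λ where
    y z (inj₁ (inj₁ w)) → inj₁ (inj₁ w)
    y z (inj₁ (inj₂ w)) → inj₂ (inj₁ w)
    y z (inj₂ pq)       → inj₁ (inj₂ pq)
  where
  weaken : ∀ {x y z} {S : Set} → W y z ⊎ S → (W y z ⊎ W x y) ⊎ S
  weaken (inj₁ w) = inj₁ (inj₁ w)
  weaken (inj₂ s) = inj₂ s
  A⊆ₓ : ∀ x → (λ y z → A y z ⊎ A x y) ⊆ (λ y z → (W y z ⊎ W x y) ⊎ P)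
  A⊆ₓ x y z (inj₁ ayz) = weaken (A⊆ y z ayz)
  A⊆ₓ x y z (inj₂ axy) with A⊆ x y axy
  ... | inj₁ w = inj₁ (inj₂ w)
  ... | inj₂ p = inj₂ p

-- Intersection theorem with unary side conditions U y, V y; the constant
-- case above handles the conditions U x, V x of the observed element x.
af-unary : {X : Set} {A B R : Rel X 0ℓ} {U V : X → Set} → AF A → AF B →
           A ⊆ (λ y z → R y z ⊎ U y) → B ⊆ (λ y z → R y z ⊎ V y) →
           AF (λ y z → R y z ⊎ (U y × V y))
af-unary (now a) afB A⊆ B⊆ = af-mono afB λ y z b → meet (A⊆ y z (a y z)) (B⊆ y z b)
af-unary (later a) (now b) A⊆ B⊆ =
  af-mono (later a) λ y z r → meet (A⊆ y z r) (B⊆ y z (b y z))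
af-unary {X} {R = R} {U} {V} (later a) (later b) A⊆ B⊆ = later λ x →
  af-mono (af-nullary (af-unary (a x) (later b) (shift A⊆ x) (λ y z r → weaken (B⊆ y z r)))
                      (af-unary (later a) (b x) (λ y z r → weaken (A⊆ y z r)) (shift B⊆ x))
                      split split) λ where
    y z (inj₁ (inj₁ (inj₁ r))) → inj₁ (inj₁ r)
    y z (inj₁ (inj₁ (inj₂ r))) → inj₂ (inj₁ r)
    y z (inj₁ (inj₂ uv))       → inj₁ (inj₂ uv)
    y z (inj₂ uvₓ)             → inj₂ (inj₂ uvₓ)
  where
  Rₓ : X → Set → Rel X 0ℓ
  Rₓ x T y z = (R y z ⊎ R x y) ⊎ T
  weaken : ∀ {x y z} {S T : Set} → R y z ⊎ S → Rₓ x T y z ⊎ S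
  weaken (inj₁ r) = inj₁ (inj₁ (inj₁ r))
  weaken (inj₂ s) = inj₂ s
  shift : {C : Rel X 0ℓ} {S : X → Set} → C ⊆ (λ y z → R y z ⊎ S y) →
          ∀ x → (λ y z → C y z ⊎ C x y) ⊆ (λ y z → Rₓ x (S x) y z ⊎ S y)
  shift C⊆ x y z (inj₁ cyz) = weaken (C⊆ y z cyz)
  shift C⊆ x y z (inj₂ cxy) with C⊆ x y cxy
  ... | inj₁ r = inj₁ (inj₁ (inj₂ r))
  ... | inj₂ s = inj₁ (inj₂ s)
  split : ∀ {x} {T : Set} → (λ y z → Rₓ x T y z ⊎ (U y × V y))
            ⊆ (λ y z → ((R y z ⊎ R x y) ⊎ (U y × V y)) ⊎ T)
  split y z (inj₁ (inj₁ r)) = inj₁ (inj₁ r)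
  split y z (inj₁ (inj₂ t)) = inj₂ t
  split y z (inj₂ uv)       = inj₁ (inj₂ uv)

af-∩ : {X : Set} {R S : Rel X 0ℓ} → AF R → AF S → AF (R ∩ S)
af-∩ (now r) afS = af-mono afS λ x y s → r x y , s
af-∩ (later r) (now s) = af-mono (later r) λ x y rxy → rxy , s x y
af-∩ (later r) (later s) = later λ x →
  af-unary (af-∩ (r x) (later s)) (af-∩ (later r) (s x))
    (λ where y z (inj₁ ryz , syz) → inj₁ (ryz , syz)
             y z (inj₂ rxy , _)   → inj₂ rxy)
    (λ where y z (ryz , inj₁ syz) → inj₁ (ryz , syz)
             y z (_ , inj₂ sxy)   → inj₂ sxy)

af-∀Fin : {X : Set} → ∀ k (R : Fin k → Rel X 0ℓ) → (∀ i → AF (R i)) →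
          AF (λ x y → ∀ i → R i x y)
af-∀Fin zero    R afR = now λ _ _ ()
af-∀Fin (suc k) R afR =
  af-mono (af-∩ (afR fz) (af-∀Fin k (λ i → R (fs i)) (λ i → afR (fs i)))) λ where
    x y (r₀ , r₊) fz     → r₀
    x y (r₀ , r₊) (fs i) → r₊ i

af-∀Vec : {X : Set} → ∀ k (R : Vec Bool k → Rel X 0ℓ) → (∀ v → AF (R v)) →
          AF (λ x y → ∀ v → R v x y)
af-∀Vec zero    R afR = af-mono (afR []) λ where x y r [] → r
af-∀Vec (suc k) R afR =
  af-mono (af-∩ (af-∀Vec k (λ v → R (true ∷ v)) (λ v → afR (true ∷ v)))
                (af-∀Vec k (λ v → R (false ∷ v)) (λ v → afR (false ∷ v)))) λ where
    x y (on , off) (true ∷ v)  → on v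
    x y (on , off) (false ∷ v) → off v

-- Equality of a bounded ℕ-valued observable is almost full: h x ≤ h y and
-- B ∸ h x ≤ B ∸ h y together force h x ≡ h y.
af-≡-bounded : {X : Set} (B : ℕ) (h : X → ℕ) → (∀ x → h x ≤ B) →
               AF (λ x y → h x ≡ h y)
af-≡-bounded B h h≤B = af-mono (af-∩ (af-pull af-≤ h) (af-pull af-≤ (λ x → B ∸ h x))) λ
  x y (up , down) → ≤-antisym up (∸-cancelʳ-≤ (h≤B y) down)

-- Equality on Bool is almost full: among three booleans two coincide.
af-Bool : AF {Bool} _≡_
af-Bool = later λ x → later λ y → now λ a _ → pigeonhole x y a
  where
  pigeonhole : ∀ x y a {b} → ((a ≡ b ⊎ x ≡ a) ⊎ (y ≡ a ⊎ x ≡ y))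
  pigeonhole true  true  a     = inj₂ (inj₂ refl)
  pigeonhole false false a     = inj₂ (inj₂ refl)
  pigeonhole true  false true  = inj₁ (inj₂ refl)
  pigeonhole true  false false = inj₂ (inj₁ refl)
  pigeonhole false true  true  = inj₂ (inj₁ refl)
  pigeonhole false true  false = inj₁ (inj₂ refl)

af-≡-Vec : {A : Set} → ∀ k → AF {A} _≡_ → AF {Vec A k} _≡_
af-≡-Vec zero    afA = now λ where [] [] → refl
af-≡-Vec (suc k) afA = af-mono (af-∩ (af-pull afA head) (af-pull (af-≡-Vec k afA) tail)) λ where
  (x ∷ xs) (y ∷ ys) (x≡y , xs≡ys) → cong₂ _∷_ x≡y xs≡ys

_≤₀_ : ℕ → ℕ → Set
a ≤₀ b = a ≤ b × (0 < b → 0 < a)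

af-≤₀ : AF _≤₀_
af-≤₀ = af-mono (af-∩ af-≤ (af-≡-bounded 1 sign sign≤1)) λ a b (a≤b , sa≡sb) → a≤b , positive sa≡sb
  where
  sign : ℕ → ℕ
  sign zero    = 0
  sign (suc _) = 1
  sign≤1 : ∀ a → sign a ≤ 1
  sign≤1 zero    = z≤n
  sign≤1 (suc _) = s≤s z≤n
  positive : ∀ {a b} → sign a ≡ sign b → 0 < b → 0 < a
  positive {suc _} _ _ = s≤s z≤n
  positive {zero} {suc _} ()

count : ∀ {m} → (Fin m → Bool) → ℕ
count {zero}  P = 0
count {suc m} P with P fz
... | true  = suc (count (λ i → P (fs i)))
... | false = count (λ i → P (fs i))

rank : ∀ {m} → (Fin m → Bool) → Fin m → ℕ
rank P fz     = 0
rank P (fs v) with P fz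
... | true  = suc (rank (λ i → P (fs i)) v)
... | false = rank (λ i → P (fs i)) v

select : ∀ {m} (P : Fin m → Bool) (t : ℕ) → t < count P → Fin m
select {zero}  P t ()
select {suc m} P t t<c with P fz
select {suc m} P zero    t<c       | true  = fz
select {suc m} P (suc t) (s≤s t<c) | true  = fs (select (λ i → P (fs i)) t t<c)
select {suc m} P t       t<c       | false = fs (select (λ i → P (fs i)) t t<c)

rank<count : ∀ {m} (P : Fin m → Bool) v → P v ≡ true → rank P v < count P
rank<count P fz Pv with P fz
rank<count P fz refl | true = s≤s z≤n
rank<count P (fs v) Pv with P fz
... | true  = s≤s (rank<count (λ i → P (fs i)) v Pv)
... | false = rank<count (λ i → P (fs i)) v Pv

select-P : ∀ {m} (P : Fin m → Bool) t t<c → P (select P t t<c) ≡ true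
select-P {zero}  P t ()
select-P {suc m} P t t<c with P fz in P₀
select-P {suc m} P zero    t<c       | true  = P₀
select-P {suc m} P (suc t) (s≤s t<c) | true  = select-P (λ i → P (fs i)) t t<c
... | false = select-P (λ i → P (fs i)) t t<c

rank-select : ∀ {m} (P : Fin m → Bool) t t<c → rank P (select P t t<c) ≡ t
rank-select {zero}  P t ()
rank-select {suc m} P t t<c with P fz in P₀
rank-select {suc m} P zero    t<c       | true = refl
rank-select {suc m} P (suc t) (s≤s t<c) | true rewrite P₀ =
  cong suc (rank-select (λ i → P (fs i)) t t<c)
... | false rewrite P₀ = rank-select (λ i → P (fs i)) t t<c

rank-injective : ∀ {m} (P : Fin m → Bool) v w → P v ≡ true → P w ≡ true →
                 rank P v ≡ rank P w → v ≡ w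
rank-injective P fz fz Pv Pw r≡ = refl
rank-injective P fz (fs w) Pv Pw r≡ with P fz
rank-injective P fz (fs w) Pv Pw () | true
rank-injective P fz (fs w) () Pw r≡ | false
rank-injective P (fs v) fz Pv Pw r≡ with P fz
rank-injective P (fs v) fz Pv Pw () | true
rank-injective P (fs v) fz Pv () r≡ | false
rank-injective P (fs v) (fs w) Pv Pw r≡ with P fz
... | true  = cong fs (rank-injective (λ i → P (fs i)) v w Pv Pw (suc-injective r≡))
... | false = cong fs (rank-injective (λ i → P (fs i)) v w Pv Pw r≡)

select-rank : ∀ {m} (P : Fin m → Bool) v (Pv : P v ≡ true) r<c → select P (rank P v) r<c ≡ v
select-rank P v Pv r<c = rank-injective P _ v (select-P P _ r<c) Pv (rank-select P _ r<c)

select-cong : ∀ {m} (P : Fin m → Bool) {t t'} t<c t'<c → t ≡ t' → select P t t<c ≡ select P t' t'<c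
select-cong P t<c t'<c refl rewrite <-irrelevant t<c t'<c = refl

count-false : ∀ {m} → count {m} (λ _ → false) ≡ 0
count-false {zero}  = refl
count-false {suc m} = count-false {m}

count-∨ : ∀ {m} (P Q : Fin m → Bool) → count (λ w → P w ∨ Q w) ≤ count P + count Q
count-∨ {zero}  P Q = z≤n
count-∨ {suc m} P Q with P fz | Q fz | count-∨ (λ i → P (fs i)) (λ i → Q (fs i))
... | true  | true  | ih = s≤s (≤-trans ih (+-monoʳ-≤ (count (λ i → P (fs i))) (n≤1+n _)))
... | true  | false | ih = s≤s ih
... | false | true  | ih = ≤-trans (s≤s ih) (≤-reflexive (sym (+-suc _ _)))
... | false | false | ih = ih

count-singleton : ∀ {m} (a : Fin m) → count (λ w → does (w ≟ a)) ≤ 1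
count-singleton {suc m} fz     = s≤s (≤-reflexive (count-false {m}))
count-singleton {suc m} (fs a) = count-singleton a

module _ {m : ℕ} where
  open import Data.List.Membership.DecPropositional (_≟_ {m}) using (_∈?_)

  count-∈ : (xs : List (Fin m)) → count (λ w → does (w ∈? xs)) ≤ length xs
  count-∈ []       = ≤-reflexive (count-false {m})
  count-∈ (x ∷ xs) = ≤-trans (count-∨ (λ w → does (w ≟ x)) (λ w → does (w ∈? xs)))
                             (+-mono-≤ (count-singleton x) (count-∈ xs))

zip-complete : {A B : Set} (E : List A) (L : List B) {ℓ : B} → length L ≤ length E →
               ℓ ∈ L → ∃ λ e → (e , ℓ) ∈ zip E L
zip-complete (e ∷ E) (_ ∷ L) _         (here refl) = e , here refl
zip-complete (e ∷ E) (_ ∷ L) (s≤s len) (there p) with zip-complete E L len p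
... | e' , q = e' , there q

module Matching (H : RGraph) where
  open import Data.List.Membership.DecPropositional (_≟_ {size H}) using (_∈?_)

  Vertex : Set
  Vertex = Fin (size H)

  endpoints : List (Vertex × Vertex) → List Vertex
  endpoints []            = []
  endpoints ((a , b) ∷ E) = a ∷ b ∷ endpoints E

  data IsMatching : List (Vertex × Vertex) → Set where
    []  : IsMatching []
    add : ∀ {a b E} → a ≢ b → Edge H a b → a ∉ endpoints E → b ∉ endpoints E →
          IsMatching E → IsMatching ((a , b) ∷ E)

  Matching : Set
  Matching = Σ (List (Vertex × Vertex)) IsMatching

  CoveredAt : List (Vertex × Vertex) → Vertex → Set
  CoveredAt E u = ∀ v → Edge H u v → u ≢ v → u ∈ endpoints E ⊎ v ∈ endpoints E

  Partner : List (Vertex × Vertex) → Vertex → Vertex → Set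
  Partner E u v = v ∉ endpoints E × u ≢ v × Edge H u v

  partner? : ∀ E u v → Dec (Partner E u v)
  partner? E u v = ¬? (v ∈? endpoints E) ×-dec ¬? (u ≟ v) ×-dec (adj H u v Bool.≟ true)

  extend : (M : Matching) (u : Vertex) → Dec (u ∈ endpoints (proj₁ M)) →
           Dec (∃ (Partner (proj₁ M) u)) → Matching
  extend M       u (yes _)  _                         = M
  extend (E , m) u (no u∉) (yes (v , v∉ , u≢v , uv)) = (u , v) ∷ E , add u≢v uv u∉ v∉ m
  extend M       u (no _)  (no _)                     = M

  extendAt : Matching → Vertex → Matching
  extendAt M u = extend M u (u ∈? endpoints (proj₁ M)) (any? (partner? (proj₁ M) u))

  extend-⊇ : ∀ M u d₁ d₂ {w} → w ∈ endpoints (proj₁ M) → w ∈ endpoints (proj₁ (extend M u d₁ d₂))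
  extend-⊇ M u (yes _) _       w∈ = w∈
  extend-⊇ M u (no _)  (yes _) w∈ = there (there w∈)
  extend-⊇ M u (no _)  (no _)  w∈ = w∈

  extend-covers : ∀ M u d₁ d₂ → CoveredAt (proj₁ (extend M u d₁ d₂)) u
  extend-covers M u (yes u∈) _       v _  _   = inj₁ u∈
  extend-covers M u (no _)   (yes _) v _  _   = inj₁ (here refl)
  extend-covers (E , m) u (no _) (no none) v uv u≢v with v ∈? endpoints E
  ... | yes v∈ = inj₂ v∈
  ... | no v∉  = ⊥-elim (none (v , v∉ , u≢v , uv))

  extendAt-⊇ : ∀ M u {w} → w ∈ endpoints (proj₁ M) → w ∈ endpoints (proj₁ (extendAt M u))
  extendAt-⊇ M u = extend-⊇ M u (u ∈? endpoints (proj₁ M)) (any? (partner? (proj₁ M) u))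

  extendAt-covers : ∀ M u → CoveredAt (proj₁ (extendAt M u)) u
  extendAt-covers M u = extend-covers M u (u ∈? endpoints (proj₁ M)) (any? (partner? (proj₁ M) u))

  covered-mono : ∀ {E E'} → (∀ {w} → w ∈ endpoints E → w ∈ endpoints E') →
                 ∀ u → CoveredAt E u → CoveredAt E' u
  covered-mono E⊆E' u cov v uv u≢v with cov v uv u≢v
  ... | inj₁ u∈ = inj₁ (E⊆E' u∈)
  ... | inj₂ v∈ = inj₂ (E⊆E' v∈)

  greedy : List Vertex → Matching → Matching
  greedy []       M = M
  greedy (u ∷ us) M = greedy us (extendAt M u)

  greedy-⊇ : ∀ us M {w} → w ∈ endpoints (proj₁ M) → w ∈ endpoints (proj₁ (greedy us M))
  greedy-⊇ []       M w∈ = w∈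
  greedy-⊇ (u ∷ us) M w∈ = greedy-⊇ us (extendAt M u) (extendAt-⊇ M u w∈)

  greedy-covers : ∀ us M u → u ∈ us → CoveredAt (proj₁ (greedy us M)) u
  greedy-covers (u ∷ us) M u (here refl) =
    covered-mono (greedy-⊇ us (extendAt M u)) u (extendAt-covers M u)
  greedy-covers (u₀ ∷ us) M u (there u∈) = greedy-covers us (extendAt M u₀) u u∈

  maximal : Matching
  maximal = greedy (allFin (size H)) ([] , [])

  maximal-covers : ∀ u → CoveredAt (proj₁ maximal) u
  maximal-covers u = greedy-covers (allFin (size H)) ([] , []) u (∈-allFin u)

  label : {A : Set} → A → List (Vertex × Vertex) → List (A × A) → Vertex → A
  label d ((a , b) ∷ E) ((x , y) ∷ L) w with w ≟ a
  ... | yes _ = x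
  ... | no _ with w ≟ b
  ... | yes _ = y
  ... | no _  = label d E L w
  label d _ _ w = d

  label-fst : ∀ {A : Set} (d : A) a b E x y L → label d ((a , b) ∷ E) ((x , y) ∷ L) a ≡ x
  label-fst d a b E x y L with a ≟ a
  ... | yes _  = refl
  ... | no a≢a = ⊥-elim (a≢a refl)

  label-snd : ∀ {A : Set} (d : A) a b E x y L → a ≢ b → label d ((a , b) ∷ E) ((x , y) ∷ L) b ≡ y
  label-snd d a b E x y L a≢b with b ≟ a
  ... | yes b≡a = ⊥-elim (a≢b (sym b≡a))
  ... | no _ with b ≟ b
  ... | yes _  = refl
  ... | no b≢b = ⊥-elim (b≢b refl)

  label-skip : ∀ {A : Set} (d : A) a b E x y L w → w ≢ a → w ≢ b →
               label d ((a , b) ∷ E) ((x , y) ∷ L) w ≡ label d E L w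
  label-skip d a b E x y L w w≢a w≢b with w ≟ a
  ... | yes w≡a = ⊥-elim (w≢a w≡a)
  ... | no _ with w ≟ b
  ... | yes w≡b = ⊥-elim (w≢b w≡b)
  ... | no _    = refl

  zip-endpoints : ∀ {A : Set} {a b} {ℓ : A} E L → ((a , b) , ℓ) ∈ zip E L →
                  a ∈ endpoints E × b ∈ endpoints E
  zip-endpoints (_ ∷ E) (_ ∷ L) (here refl) = here refl , there (here refl)
  zip-endpoints (_ ∷ E) (_ ∷ L) (there p) with zip-endpoints E L p
  ... | a∈ , b∈ = there (there a∈) , there (there b∈)

  -- Along a matching, each edge's endpoints carry exactly the paired labels:
  -- the edges matched earlier are disjoint from the edge being labelled.
  realise : ∀ {A : Set} (d : A) {E a b x y} L → IsMatching E → ((a , b) , (x , y)) ∈ zip E L →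
            label d E L a ≡ x × label d E L b ≡ y × Edge H a b
  realise d {(a , b) ∷ E} (_ ∷ L) (add a≢b ab _ _ _) (here refl) =
    label-fst d a b E _ _ L , label-snd d a b E _ _ L a≢b , ab
  realise d {(a₀ , b₀) ∷ E} {a} {b} ((x₀ , y₀) ∷ L) (add _ _ a₀∉ b₀∉ m) (there p)
    with zip-endpoints E L p | realise d L m p
  ... | a∈ , b∈ | la , lb , ab =
    trans (label-skip d a₀ b₀ E x₀ y₀ L a (apart a∈ a₀∉) (apart a∈ b₀∉)) la ,
    trans (label-skip d a₀ b₀ E x₀ y₀ L b (apart b∈ a₀∉) (apart b∈ b₀∉)) lb , ab
    where
    apart : ∀ {w v} → w ∈ endpoints E → v ∉ endpoints E → w ≢ v
    apart w∈ v∉ refl = v∉ w∈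

  length-endpoints : ∀ E → length (endpoints E) ≡ length E + length E
  length-endpoints []      = refl
  length-endpoints (_ ∷ E) = cong suc (trans (cong suc (length-endpoints E)) (sym (+-suc _ _)))

  matched : Vertex → Bool
  matched w = does (w ∈? endpoints (proj₁ maximal))

  matched-covers : ∀ u v → Edge H u v → u ≢ v → matched u ≡ true ⊎ matched v ≡ true
  matched-covers u v uv u≢v with maximal-covers u v uv u≢v
  ... | inj₁ u∈ = inj₁ (dec-true (u ∈? endpoints (proj₁ maximal)) u∈)
  ... | inj₂ v∈ = inj₂ (dec-true (v ∈? endpoints (proj₁ maximal)) v∈)

  matched-count : count matched ≤ length (proj₁ maximal) + length (proj₁ maximal)
  matched-count = ≤-trans (count-∈ (endpoints (proj₁ maximal)))
                          (≤-reflexive (length-endpoints (proj₁ maximal)))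

  -- A matching with at least n² edges exhibits K n as a strong image of H:
  -- label the i-th matched edge by the i-th pair of vertices of K n.
  completeImage : ∀ n' (M : Matching) → suc n' * suc n' ≤ length (proj₁ M) → K (suc n') ≼ H
  completeImage n' (E , m) big = φ , (λ _ _ _ → refl) , (λ i j _ → realisePair (φ i) (φ j)) , surj
    where
    n : ℕ
    n = suc n'
    pairs : List (Fin n × Fin n)
    pairs = tabulateᴸ (remQuot n)
    φ : Vertex → Fin n
    φ = label fz E pairs
    realisePair : ∀ x y → Σ Vertex λ a → Σ Vertex λ b → φ a ≡ x × φ b ≡ y × Edge H a b
    realisePair x y
      with zip-complete E pairs (≤-trans (≤-reflexive (length-tabulate (remQuot n))) big)
                        (subst (_∈ pairs) (remQuot-combine x y) (∈-tabulate⁺ {f = remQuot n} (combine x y)))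
    ... | (a , b) , p = a , b , realise fz pairs m p
    surj : IsSurj φ
    surj y with realisePair y y
    ... | a , _ , φa≡y , _ = a , φa≡y

witness : {P : Set} (d : Dec P) → does d ≡ true → P
witness (yes p) _ = p

true≢false : true ≢ false
true≢false ()

module Coding (κ : ℕ) where

  record Cover (H : RGraph) : Set where
    field
      inCover : Fin (size H) → Bool
      covers  : ∀ u v → Edge H u v → u ≢ v → inCover u ≡ true ⊎ inCover v ≡ true
      bounded : count inCover ≤ κ

  -- The adjacency pattern of a vertex towards the (at most κ) cover vertices.
  Profile : Set
  Profile = Vec Bool κ

  _≟ᴾ_ : (S T : Profile) → Dec (S ≡ T)
  _≟ᴾ_ = ≡-dec-Vec Bool._≟_

  -- The data of a covered graph from which it is reconstructed up to the
  -- multiplicity of non-cover vertices: the cover vertices in rank order,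
  -- their adjacencies, and the profiles of the remaining vertices.
  module Shape (H : RGraph) (C : Cover H) where
    open Cover C public

    Vertex : Set
    Vertex = Fin (size H)

    coverSize : ℕ
    coverSize = count inCover

    belowκ : ∀ {r} → r < coverSize → r < κ
    belowκ r<c = <-≤-trans r<c bounded

    coverVertex : (r : ℕ) → r < coverSize → Vertex
    coverVertex = select inCover

    toCover : Vertex → ℕ → Bool
    toCover v r with r <? coverSize
    ... | yes r<c = adj H v (coverVertex r r<c)
    ... | no _    = false

    toCover-at : ∀ v r (r<c : r < coverSize) → toCover v r ≡ adj H v (coverVertex r r<c)
    toCover-at v r r<c with r <? coverSize
    ... | yes r<c' = cong (adj H v) (select-cong inCover r<c' r<c refl)
    ... | no r≮c   = ⊥-elim (r≮c r<c)

    profile : Vertex → Profile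
    profile v = tabulate λ k → toCover v (toℕ k)

    profile-at : ∀ v r (r<c : r < coverSize) →
                 lookup (profile v) (fromℕ< (belowκ r<c)) ≡ adj H v (coverVertex r r<c)
    profile-at v r r<c =
      trans (lookup∘tabulate _ (fromℕ< (belowκ r<c)))
            (trans (cong (toCover v) (toℕ-fromℕ< (belowκ r<c))) (toCover-at v r r<c))

    core : Fin κ → Profile
    core r with toℕ r <? coverSize
    ... | yes r<c = profile (coverVertex (toℕ r) r<c)
    ... | no _    = replicate κ false

    core-at : ∀ r (r<c : r < coverSize) → core (fromℕ< (belowκ r<c)) ≡ profile (coverVertex r r<c)
    core-at r r<c with toℕ (fromℕ< (belowκ r<c)) <? coverSize
    ... | yes r<c' = cong profile (select-cong inCover r<c' r<c (toℕ-fromℕ< (belowκ r<c)))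
    ... | no r≮c   = ⊥-elim (r≮c (subst (_< coverSize) (sym (toℕ-fromℕ< (belowκ r<c))) r<c))

    hasProfile? : ∀ S v → Dec (inCover v ≡ false × profile v ≡ S)
    hasProfile? S v = (inCover v Bool.≟ false) ×-dec (profile v ≟ᴾ S)

    hasProfile : Profile → Vertex → Bool
    hasProfile S v = does (hasProfile? S v)

    population : Profile → ℕ
    population S = count (hasProfile S)

    hasProfile-sound : ∀ S v → hasProfile S v ≡ true → inCover v ≡ false × profile v ≡ S
    hasProfile-sound S v = witness (hasProfile? S v)

    hasProfile-own : ∀ v → inCover v ≡ false → hasProfile (profile v) v ≡ true
    hasProfile-own v out = dec-true (hasProfile? (profile v) v) (out , refl)

    pick : (S : Profile) → ℕ → 0 < population S → Vertex
    pick S t pos with t <? population S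
    ... | yes t<p = select (hasProfile S) t t<p
    ... | no _    = select (hasProfile S) 0 pos

    pick-has : ∀ S t pos → hasProfile S (pick S t pos) ≡ true
    pick-has S t pos with t <? population S
    ... | yes t<p = select-P (hasProfile S) t t<p
    ... | no _    = select-P (hasProfile S) 0 pos

    pick-below : ∀ S t pos (t<p : t < population S) → pick S t pos ≡ select (hasProfile S) t t<p
    pick-below S t pos t<p with t <? population S
    ... | yes t<p' = select-cong (hasProfile S) t<p' t<p refl
    ... | no t≮p   = ⊥-elim (t≮p t<p)

    pick-cong : ∀ {S S' t t'} pos pos' → S ≡ S' → t ≡ t' → pick S t pos ≡ pick S' t' pos'
    pick-cong pos pos' refl refl rewrite <-irrelevant pos pos' = refl

    outside-edge : ∀ u v → inCover u ≡ false → inCover v ≡ false → Edge H u v → u ≡ v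
    outside-edge u v u∉ v∉ uv with u ≟ v
    ... | yes u≡v = u≡v
    ... | no u≢v with covers u v uv u≢v
    ... | inj₁ u∈ = ⊥-elim (true≢false (trans (sym u∈) u∉))
    ... | inj₂ v∈ = ⊥-elim (true≢false (trans (sym v∈) v∉))

  record _⊑_ {G G' : RGraph} (C : Cover G) (C' : Cover G') : Set where
    module A = Shape G C
    module B = Shape G' C'
    field
      same-size : A.coverSize ≡ B.coverSize
      same-core : ∀ r → A.core r ≡ B.core r
      fewer     : ∀ S → A.population S ≤ B.population S
      inhabited : ∀ S → 0 < B.population S → 0 < A.population S

  -- If C ⊑ C' then G is a strong homomorphic image of G': send each cover
  -- vertex to the cover vertex of G of the same rank, and the t-th non-cover
  -- vertex of a given profile to the t-th such vertex of G (or the first one).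
  module Embedding {G G' : RGraph} {C : Cover G} {C' : Cover G'} (C⊑C' : C ⊑ C') where
    open _⊑_ C⊑C'

    toA : ∀ {r} → r < B.coverSize → r < A.coverSize
    toA {r} = subst (r <_) (sym same-size)

    inhabited-at : ∀ v → B.inCover v ≡ false → 0 < A.population (B.profile v)
    inhabited-at v out = inhabited _ (≤-<-trans z≤n (rank<count _ v (B.hasProfile-own v out)))

    φ-by : ∀ v b → B.inCover v ≡ b → A.Vertex
    φ-by v true  v∈ = A.coverVertex (rank B.inCover v) (toA (rank<count B.inCover v v∈))
    φ-by v false v∉ = A.pick (B.profile v) (rank (B.hasProfile (B.profile v)) v) (inhabited-at v v∉)

    φ : B.Vertex → A.Vertex
    φ v = φ-by v (B.inCover v) refl

    φ-at : ∀ v b (e : B.inCover v ≡ b) → φ v ≡ φ-by v b e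
    φ-at v _ refl = refl

    φ-inside : ∀ v (v∈ : B.inCover v ≡ true) (r<c : rank B.inCover v < A.coverSize) →
               φ v ≡ A.coverVertex (rank B.inCover v) r<c
    φ-inside v v∈ r<c = trans (φ-at v true v∈) (select-cong A.inCover _ r<c refl)

    φ-outside : ∀ v → B.inCover v ≡ false → ∀ {S t} pos → B.profile v ≡ S →
                rank (B.hasProfile (B.profile v)) v ≡ t → φ v ≡ A.pick S t pos
    φ-outside v v∉ pos v-profile v-rank = trans (φ-at v false v∉) (A.pick-cong _ pos v-profile v-rank)

    -- φ preserves profiles: for cover vertices because the cores agree.
    φ-by-profile : ∀ v b (e : B.inCover v ≡ b) → A.profile (φ-by v b e) ≡ B.profile v
    φ-by-profile v true v∈ = begin
      A.profile (A.coverVertex r (toA r<c)) ≡⟨ sym (A.core-at r (toA r<c)) ⟩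
      A.core (fromℕ< (B.belowκ r<c))        ≡⟨ same-core _ ⟩
      B.core (fromℕ< (B.belowκ r<c))        ≡⟨ B.core-at r r<c ⟩
      B.profile (B.coverVertex r r<c)       ≡⟨ cong B.profile (select-rank B.inCover v v∈ r<c) ⟩
      B.profile v                           ∎
      where
      open ≡-Reasoning
      r : ℕ
      r = rank B.inCover v
      r<c : r < B.coverSize
      r<c = rank<count B.inCover v v∈
    φ-by-profile v false v∉ = proj₂ (A.hasProfile-sound _ _ (A.pick-has _ _ _))

    φ-profile : ∀ v → A.profile (φ v) ≡ B.profile v
    φ-profile v = φ-by-profile v (B.inCover v) refl

    φ-outside-cover : ∀ v → B.inCover v ≡ false → A.inCover (φ v) ≡ false
    φ-outside-cover v v∉ = subst (λ w → A.inCover w ≡ false) (sym (φ-at v false v∉))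
                                 (proj₁ (A.hasProfile-sound _ _ (A.pick-has _ _ _)))

    -- Adjacency to a cover vertex is read off from profiles, which φ preserves.
    φ-adj-cover : ∀ u v → B.inCover v ≡ true → adj G (φ u) (φ v) ≡ adj G' u v
    φ-adj-cover u v v∈ = begin
      adj G (φ u) (φ v)                       ≡⟨ cong (adj G (φ u)) (φ-inside v v∈ (toA r<c)) ⟩
      adj G (φ u) (A.coverVertex r (toA r<c)) ≡⟨ sym (A.profile-at (φ u) r (toA r<c)) ⟩
      lookup (A.profile (φ u)) k              ≡⟨ cong (λ S → lookup S k) (φ-profile u) ⟩
      lookup (B.profile u) k                  ≡⟨ B.profile-at u r r<c ⟩
      adj G' u (B.coverVertex r r<c)          ≡⟨ cong (adj G' u) (select-rank B.inCover v v∈ r<c) ⟩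
      adj G' u v                              ∎
      where
      open ≡-Reasoning
      r : ℕ
      r = rank B.inCover v
      r<c : r < B.coverSize
      r<c = rank<count B.inCover v v∈
      k : Fin κ
      k = fromℕ< (B.belowκ r<c)

    φ-adj : ∀ u v → B.inCover u ≡ true ⊎ B.inCover v ≡ true → adj G (φ u) (φ v) ≡ adj G' u v
    φ-adj u v (inj₁ u∈) = trans (symm G (φ u) (φ v)) (trans (φ-adj-cover v u u∈) (symm G' v u))
    φ-adj u v (inj₂ v∈) = φ-adj-cover u v v∈

    cover-cases : ∀ u v → (B.inCover u ≡ true ⊎ B.inCover v ≡ true) ⊎
                          (B.inCover u ≡ false × B.inCover v ≡ false)
    cover-cases u v with B.inCover u | B.inCover v
    ... | true  | _     = inj₁ (inj₁ refl)
    ... | false | true  = inj₁ (inj₂ refl)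
    ... | false | false = inj₂ (refl , refl)

    -- Off the cover, edges are loops on both sides.
    φ-hom : IsHom G' G φ
    φ-hom u v uv with cover-cases u v
    ... | inj₁ touches     = trans (φ-adj u v touches) uv
    ... | inj₂ (u∉ , v∉) with B.outside-edge u v u∉ v∉ uv
    ... | refl = loops G (φ u)

    φ-strong : IsStrong G' G φ
    φ-strong u v e with cover-cases u v
    ... | inj₁ touches = u , v , refl , refl , trans (sym (φ-adj u v touches)) e
    ... | inj₂ (u∉ , v∉) =
      u , u , refl , A.outside-edge (φ u) (φ v) (φ-outside-cover u u∉) (φ-outside-cover v v∉) e , loops G' u

    -- Surjectivity on the cover: the cover vertex of G of rank r is the image
    -- of the cover vertex of G' of rank r.
    φ-onto-cover : ∀ w → A.inCover w ≡ true → Σ B.Vertex λ v → φ v ≡ w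
    φ-onto-cover w w∈ = v , (begin
      φ v                                          ≡⟨ φ-inside v v∈ (toA (rank<count B.inCover v v∈)) ⟩
      A.coverVertex (rank B.inCover v) (toA (rank<count B.inCover v v∈))
                                                   ≡⟨ select-cong A.inCover _ r<cA (rank-select B.inCover r r<cB) ⟩
      A.coverVertex r r<cA                         ≡⟨ select-rank A.inCover w w∈ r<cA ⟩
      w                                            ∎)
      where
      open ≡-Reasoning
      r : ℕ
      r = rank A.inCover w
      r<cA : r < A.coverSize
      r<cA = rank<count A.inCover w w∈
      r<cB : r < B.coverSize
      r<cB = subst (r <_) same-size r<cA
      v : B.Vertex
      v = B.coverVertex r r<cB
      v∈ : B.inCover v ≡ true
      v∈ = select-P B.inCover r r<cB

    -- Surjectivity off the cover: the t-th vertex of G with profile S is the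
    -- image of the t-th vertex of G' with profile S, which exists as G' has more.
    φ-onto-outside : ∀ w → A.inCover w ≡ false → Σ B.Vertex λ v → φ v ≡ w
    φ-onto-outside w w∉ = v , (begin
      φ v                             ≡⟨ φ-outside v v∉ 0<pA v-profile v-rank ⟩
      A.pick S t 0<pA                 ≡⟨ A.pick-below S t 0<pA t<pA ⟩
      select (A.hasProfile S) t t<pA  ≡⟨ select-rank (A.hasProfile S) w w-has t<pA ⟩
      w                               ∎)
      where
      open ≡-Reasoning
      S : Profile
      S = A.profile w
      w-has : A.hasProfile S w ≡ true
      w-has = A.hasProfile-own w w∉
      t : ℕ
      t = rank (A.hasProfile S) w
      t<pA : t < A.population S
      t<pA = rank<count (A.hasProfile S) w w-has
      0<pA : 0 < A.population S
      0<pA = ≤-<-trans z≤n t<pA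
      t<pB : t < B.population S
      t<pB = <-≤-trans t<pA (fewer S)
      v : B.Vertex
      v = select (B.hasProfile S) t t<pB
      v-sound : B.inCover v ≡ false × B.profile v ≡ S
      v-sound = B.hasProfile-sound S v (select-P (B.hasProfile S) t t<pB)
      v∉ : B.inCover v ≡ false
      v∉ = proj₁ v-sound
      v-profile : B.profile v ≡ S
      v-profile = proj₂ v-sound
      v-rank : rank (B.hasProfile (B.profile v)) v ≡ t
      v-rank = trans (cong (λ T → rank (B.hasProfile T) v) v-profile) (rank-select (B.hasProfile S) t t<pB)

    φ-surj : IsSurj φ
    φ-surj w with A.inCover w in w∈?
    ... | true  = φ-onto-cover w w∈?
    ... | false = φ-onto-outside w w∈?

    image : G ≼ G'
    image = φ , φ-hom , φ-strong , φ-surj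

  -- Comparing a sequence of covered graphs by their codes is almost full:
  -- it is an intersection of finitely many almost full relations.
  af-⊑ : (G : ℕ → RGraph) (C : ∀ i → Cover (G i)) → AF (λ i j → C i ⊑ C j)
  af-⊑ G C = af-mono (af-∩ sizes (af-∩ cores populations)) λ i j (size≡ , core≡ , pop≤) →
    record { same-size = size≡ ; same-core = core≡
           ; fewer = λ S → proj₁ (pop≤ S) ; inhabited = λ S → proj₂ (pop≤ S) }
    where
    module Sh (i : ℕ) = Shape (G i) (C i)
    sizes : AF (λ i j → Sh.coverSize i ≡ Sh.coverSize j)
    sizes = af-≡-bounded κ Sh.coverSize Sh.bounded
    cores : AF (λ i j → ∀ r → Sh.core i r ≡ Sh.core j r)
    cores = af-∀Fin κ (λ r i j → Sh.core i r ≡ Sh.core j r)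
                      (λ r → af-pull (af-≡-Vec κ af-Bool) (λ i → Sh.core i r))
    populations : AF (λ i j → ∀ S → Sh.population i S ≤₀ Sh.population j S)
    populations = af-∀Vec κ (λ S i j → Sh.population i S ≤₀ Sh.population j S)
                            (λ S → af-pull af-≤₀ (λ i → Sh.population i S))

≼-refl : ∀ A → A ≼ A
≼-refl A = (λ x → x) , (λ i j e → e) , (λ i j e → i , j , refl , refl , e) , λ y → y , refl

≼-trans : ∀ {A B C} → A ≼ B → B ≼ C → A ≼ C
≼-trans {A} {B} {C} (ψ , ψ-hom , ψ-strong , ψ-surj) (φ , φ-hom , φ-strong , φ-surj) =
  (λ x → ψ (φ x)) , (λ i j e → ψ-hom _ _ (φ-hom i j e)) , strong , surj
  where
  strong : IsStrong C A (λ x → ψ (φ x))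
  strong i j e with ψ-strong (φ i) (φ j) e
  ... | i₁ , j₁ , ψi₁ , ψj₁ , e₁ with φ-surj i₁ | φ-surj j₁
  ... | i₂ , refl | j₂ , refl with φ-strong i₂ j₂ e₁
  ... | i₃ , j₃ , φi₃ , φj₃ , e₃ = i₃ , j₃ , trans (cong ψ φi₃) ψi₁ , trans (cong ψ φj₃) ψj₁ , e₃
  surj : IsSurj (λ x → ψ (φ x))
  surj y with ψ-surj y
  ... | b , refl with φ-surj b
  ... | c , refl = c , refl

chain-≼ : (f : ℕ → RGraph) → (∀ i → f (suc i) ≼ f i) → ∀ {i j} → i ≤ j → f j ≼ f i
chain-≼ f step {i} {j} i≤j = subst (λ k → f k ≼ f i) (m∸n+n≡m i≤j) (down (j ∸ i))
  where
  down : ∀ d → f (d + i) ≼ f i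
  down zero    = ≼-refl (f i)
  down (suc d) = ≼-trans {f (suc d + i)} {f (d + i)} {f i} (step (d + i)) (down d)

Good : (ℕ → RGraph) → Set
Good f = Σ ℕ λ i → Σ ℕ λ j → i < j × f i ≼ f j

good-not-descending : ∀ f → Good f → ¬ (∀ i → f (suc i) ≺ f i)
good-not-descending f (i , j , i<j , fi≼fj) desc =
  proj₂ (desc i) (≼-trans {f i} {f j} {f (suc i)} fi≼fj (chain-≼ f (λ k → proj₁ (desc k)) i<j))

good-not-antichain : ∀ f → Good f → ¬ (∀ i j → i ≢ j → ¬ (f i ≼ f j))
good-not-antichain f (i , j , i<j , fi≼fj) anti = anti i j (<⇒≢ i<j) fi≼fj

-- Every graph avoiding K n has a vertex cover with at most 2n² vertices: the
-- endpoints of a maximal matching, which has fewer than n² edges.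
coverBound : ℕ → ℕ
coverBound n = n * n + n * n

avoider-cover : ∀ n' H → InAv (suc n') H → Coding.Cover (coverBound (suc n')) H
avoider-cover n' H avoids with suc n' * suc n' ≤? length (proj₁ (Matching.maximal H))
... | yes large = ⊥-elim (avoids (Matching.completeImage H n' (Matching.maximal H) large))
... | no small  = record
  { inCover = Matching.matched H
  ; covers  = Matching.matched-covers H
  ; bounded = ≤-trans (Matching.matched-count H) (+-mono-≤ fewer fewer) }
  where
  fewer : length (proj₁ (Matching.maximal H)) ≤ suc n' * suc n'
  fewer = <⇒≤ (≰⇒> small)

-- Sequences in Av(K n) are good: compare the codes of their small covers.
avoiders-good : ∀ n' (f : ℕ → RGraph) → (∀ i → InAv (suc n') (f i)) → Good f
avoiders-good n' f avoid = codes-good (good (af-⊑ f covers) (λ i → i))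
  where
  open Coding (coverBound (suc n'))
  covers : ∀ i → Cover (f i)
  covers i = avoider-cover n' (f i) (avoid i)
  codes-good : (Σ ℕ λ i → Σ ℕ λ j → i < j × covers i ⊑ covers j) → Good f
  codes-good (i , j , i<j , code≤) = i , j , i<j , Embedding.image code≤

theorem3p6 : (n : ℕ) → n ≥ 1 → WQO (InAv n)
theorem3p6 (suc n') _ =
  (λ (f , avoid , descending) → good-not-descending f (avoiders-good n' f avoid) descending) ,
  (λ (f , avoid , antichain)  → good-not-antichain f (avoiders-good n' f avoid) antichain)
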